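{- Let $G=(A,B;E)$ be a bipartite factorizable graph, $M$ a perfect matching of $G$, and $D_1,D_2$ DM-components of $G$ with $D_1\le_A D_2$. Then for any $u\in V(D_1)\cap A$ and $v\in V(D_2)\cap B$, every $M$-saturated path $P$ between $u$ and $v$ contains a vertex of $A\cap V(D_2)$.
   Context: All graphs are finite. A graph is factorizable if it has a perfect matching; an edge is allowed if it lies in some perfect matching. For a factorizable graph, for each connected component $C$ of the subgraph formed by the allowed edges, $G[V(C)]$ is a factor-component. For a bipartite factorizable graph with color classes $A,B$, its DM-components are its factor-components, and $\le_A$ is the reflexive–transitive closure of the relation $\{(G_j,G_i): \text{some edge joins } B\cap V(G_j)\text{ and } A\cap V(G_i)\}$ on DM-components (this is a partial order). An $M$-saturated path between $u$ and $v$ is a path with ends $u,v$ and an odd number of edges such that $M\cap E(P)$ is a perfect matching of $P$ and $E(P)\setminus M$ is a matching. -}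

module Defs where

open import Data.Nat using (ℕ; suc; _+_; _*_)
open import Data.Fin using (Fin; zero; suc; inject₁; fromℕ)
open import Data.Bool using (Bool; true; false)
open import Data.Product using (Σ; _×_; ∃)
open import Data.Sum using (_⊎_)
open import Data.Empty using (⊥)
open import Relation.Nullary using (¬_)
open import Relation.Binary.PropositionalEquality using (_≡_; _≢_)
open import Relation.Binary.Construct.Closure.ReflexiveTransitive using (Star)
open import Function.Definitions using (Injective)

record Graph (n : ℕ) : Set₁ where
  field
    Adj   : Fin n → Fin n → Set
    sym   : ∀ {u v} → Adj u v → Adj v u
    irrefl : ∀ {v} → ¬ Adj v v

record BipartiteGraph (n : ℕ) : Set₁ where
  field
    graph  : Graph n
    colour : Fin n → Bool
    bip    : ∀ {u v} → Graph.Adj graph u v → colour u ≢ colour v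
  open Graph graph public

  InA : Fin n → Set
  InA v = colour v ≡ true

  InB : Fin n → Set
  InB v = colour v ≡ false

-- A perfect matching, given by the mate function: M = { {v, mate v} }.
record PerfectMatching {n : ℕ} (G : Graph n) : Set where
  field
    mate  : Fin n → Fin n
    adj   : ∀ v → Graph.Adj G v (mate v)
    invol : ∀ v → mate (mate v) ≡ v

module _ {n : ℕ} (G : BipartiteGraph n) where
  open BipartiteGraph G

  Allowed : Fin n → Fin n → Set
  Allowed u v = Adj u v × Σ (PerfectMatching graph) (λ M → PerfectMatching.mate M u ≡ v)

  -- x and y lie in the same connected component of the subgraph
  -- formed by the allowed edges; DM-components are the vertex sets
  -- { y | SameDM r y } for vertices r.
  SameDM : Fin n → Fin n → Set
  SameDM = Star Allowed

  -- generating relation of ≤_A on DM-components, via representatives: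
  -- GenA x y : some edge joins B ∩ V(comp x) and A ∩ V(comp y)
  GenA : Fin n → Fin n → Set
  GenA x y = Σ (Fin n) λ b → Σ (Fin n) λ a →
    SameDM x b × InB b × SameDM y a × InA a × Adj b a

  LeA : Fin n → Fin n → Set
  LeA = Star GenA

record Path {n : ℕ} (G : Graph n) (k : ℕ) : Set where
  field
    vert : Fin (suc k) → Fin n
    inj  : Injective _≡_ _≡_ vert
    adj  : ∀ (i : Fin k) → Graph.Adj G (vert (inject₁ i)) (vert (suc i))

IncidentP : {k : ℕ} → Fin k → Fin (suc k) → Set
IncidentP i j = (j ≡ inject₁ i) ⊎ (j ≡ suc i)

module _ {n : ℕ} {G : Graph n} (M : PerfectMatching G) {k : ℕ} (P : Path G k) where
  open PerfectMatching M
  open Path P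

  EdgeInM : Fin k → Set
  EdgeInM i = mate (vert (inject₁ i)) ≡ vert (suc i)

  -- M-saturated: odd number of edges, M ∩ E(P) is a perfect matching of P,
  -- E(P) \ M is a matching
  MSaturated : Set
  MSaturated =
    Σ ℕ (λ t → k ≡ 1 + 2 * t)
    × (∀ (j : Fin (suc k)) →
         Σ (Fin k) (λ i → IncidentP i j × EdgeInM i)
         × (∀ i i' → IncidentP i j → EdgeInM i → IncidentP i' j → EdgeInM i' → i ≡ i'))
    × (∀ (j : Fin (suc k)) i i' → IncidentP i j → ¬ EdgeInM i →
         IncidentP i' j → ¬ EdgeInM i' → i ≡ i')

  Between : Fin n → Fin n → Set
  Between u v = (vert zero ≡ u × vert (fromℕ k) ≡ v) ⊎ (vert zero ≡ v × vert (fromℕ k) ≡ u)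

-- The mate of v lies on P, because an M-saturated path covers each of its
-- vertices by an M-edge of the path; it lies in A, because M-edges join the
-- two colour classes; and it lies in the DM-component of v, because every
-- edge of a perfect matching is allowed.
module Submission where

open import Defs
open import Data.Nat using (ℕ; suc)
open import Data.Fin using (Fin; zero; suc; inject₁; fromℕ)
open import Data.Bool using (not)
open import Data.Bool.Properties using (¬-not)
open import Data.Product using (Σ; _×_; _,_; proj₁)
open import Data.Sum using (inj₁; inj₂)
open import Relation.Binary.PropositionalEquality
  using (_≡_; refl; sym; trans; cong; subst; ≢-sym; module ≡-Reasoning)
open import Relation.Binary.Construct.Closure.ReflexiveTransitive using (ε; _◅_; _◅◅_)

module _ {n : ℕ} {G : Graph n} {k : ℕ} (P : Path G k) where
  open Path P

  OnPath : Fin n → Set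
  OnPath x = Σ (Fin (suc k)) λ j → vert j ≡ x

  onPath-witness : ∀ {x} (Q : Fin n → Set) → OnPath x → Q x →
    Σ (Fin (suc k)) λ j → Q (vert j)
  onPath-witness Q (j , vert-j≡x) qx = j , subst Q (sym vert-j≡x) qx

  module _ (M : PerfectMatching G) where
    open PerfectMatching M

    between-onPath : ∀ {u v} → Between M P u v → OnPath v
    between-onPath (inj₁ (_ , last≡v))  = fromℕ k , last≡v
    between-onPath (inj₂ (first≡v , _)) = zero , first≡v

    mate-onPath : MSaturated M P → ∀ {x} → OnPath x → OnPath (mate x)
    mate-onPath (_ , covered , _) {x} (j , refl) with proj₁ (covered j)
    ... | i , inj₁ refl , inM = suc i , sym inM
    ... | i , inj₂ refl , inM = inject₁ i , (begin
      vert (inject₁ i)              ≡⟨ sym (invol _) ⟩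
      mate (mate (vert (inject₁ i))) ≡⟨ cong mate inM ⟩
      mate (vert (suc i))           ∎)
      where open ≡-Reasoning

module _ {n : ℕ} (G : BipartiteGraph n) where
  open BipartiteGraph G

  InB-Adj⇒InA : ∀ {b a} → InB b → Adj b a → InA a
  InB-Adj⇒InA b∈B e = trans (¬-not (≢-sym (bip e))) (cong not b∈B)

  module _ (M : PerfectMatching graph) where
    open PerfectMatching M

    mate-allowed : ∀ v → Allowed G v (mate v)
    mate-allowed v = adj v , M , refl

    SameDM-mate : ∀ {d v} → SameDM G d v → SameDM G d (mate v)
    SameDM-mate {v = v} d~v = d~v ◅◅ (mate-allowed v ◅ ε)

lemma1 : {n : ℕ} (G : BipartiteGraph n) (M : PerfectMatching (BipartiteGraph.graph G))
    (d₁ d₂ : Fin n) → LeA G d₁ d₂ →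
    (u v : Fin n) → SameDM G d₁ u → BipartiteGraph.InA G u →
    SameDM G d₂ v → BipartiteGraph.InB G v →
    (k : ℕ) (P : Path (BipartiteGraph.graph G) k) → MSaturated M P → Between M P u v →
    Σ (Fin (ℕ.suc k)) λ j → BipartiteGraph.InA G (Path.vert P j) × SameDM G d₂ (Path.vert P j)
lemma1 G M _ d₂ _ _ v _ _ d₂~v v∈B k P sat between =
  onPath-witness P (λ x → InA x × SameDM G d₂ x)
    (mate-onPath P M sat (between-onPath P M between))
    (InB-Adj⇒InA G v∈B (adj v) , SameDM-mate G M d₂~v)
  where
  open BipartiteGraph G using (InA)
  open PerfectMatching M using (adj)
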